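{- For every integer $n\ge 2$, the star $S_n = K_{1,n-1}$ satisfies $$\mathrm{avg}_1(S_n) = 3 - \frac{2^n}{3^{n-1}} \qquad\text{and}\qquad \mathrm{avg}_{\pm 1}(S_n) = 3 - 2^{2-n}.$$
   Context: The star $S_n$ is the tree on $n$ vertices with one vertex of degree $n-1$ and $n-1$ leaves, i.e. $K_{1,n-1}$. Let $G=(V,E)$ be a finite connected graph with a fixed root $v_0$. For $M\in\mathbb{N}$, an $M$-Lipschitz mapping is $f:V\to\mathbb{Z}$ with $f(v_0)=0$ and $|f(u)-f(v)|\le M$ for all edges $uv$; the set of these is $\mathcal{L}_M(G)$. A strong $M$-Lipschitz mapping is $f:V\to\mathbb{Z}$ with $f(v_0)=0$ and $|f(u)-f(v)|=M$ for all edges $uv$; the set of these is $\mathcal{L}_{\pm M}(G)$. The range of $f$ is $\mathrm{rng}(f)=|\{f(v):v\in V\}|$. The average ranges are $\mathrm{avg}_M(G)=\frac{\sum_{f\in\mathcal{L}_M(G)}\mathrm{rng}(f)}{|\mathcal{L}_M(G)|}$ and $\mathrm{avg}_{\pm M}(G)=\frac{\sum_{f\in\mathcal{L}_{\pm M}(G)}\mathrm{rng}(f)}{|\mathcal{L}_{\pm M}(G)|}$ (independent of the choice of root; e.g. root the star at its center). -}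

module Defs where

open import Data.Nat as ℕ using (ℕ; zero; suc; NonZero)
open import Data.Nat.Properties using (m^n≢0)
open import Data.Integer as ℤ using (ℤ; +_; ∣_∣; _-_)
open import Data.Fin using (Fin; zero; suc)
open import Data.Nat.ListAction using (sum)
open import Data.List using (List; []; _∷_; map; length; deduplicate; allFin)
open import Data.List.Membership.Propositional using (_∈_)
open import Data.List.Relation.Unary.AllPairs using (AllPairs)
open import Data.Rational as ℚ using (ℚ; _/_; 0ℚ)
open import Data.Product using (Σ; ∃; _×_)
open import Data.Sum using (_⊎_)
open import Relation.Nullary using (¬_)
open import Relation.Binary.PropositionalEquality using (_≡_; _≢_)

record RootedGraph : Set₁ where
  field
    size : ℕ
    Adj  : Fin size → Fin size → Set
    root : Fin size
open RootedGraph public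

-- The star S_{m+1} = K_{1,m}: vertices Fin (suc m), centre zero (the root),
-- edges exactly between the centre and every other vertex.
Star : ℕ → RootedGraph
Star m = record
  { size = suc m
  ; Adj  = λ i j → (i ≡ zero × j ≢ zero) ⊎ (j ≡ zero × i ≢ zero)
  ; root = zero
  }

_≗_ : ∀ {n} → (Fin n → ℤ) → (Fin n → ℤ) → Set
f ≗ g = ∀ v → f v ≡ g v

IsLipschitz : (G : RootedGraph) → ℕ → (Fin (size G) → ℤ) → Set
IsLipschitz G M f =
  f (root G) ≡ + 0 × (∀ u v → Adj G u v → ∣ f u - f v ∣ ℕ.≤ M)

IsStrongLipschitz : (G : RootedGraph) → ℕ → (Fin (size G) → ℤ) → Set
IsStrongLipschitz G M f =
  f (root G) ≡ + 0 × (∀ u v → Adj G u v → ∣ f u - f v ∣ ≡ M)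

rng : ∀ {n} → (Fin n → ℤ) → ℕ
rng {n} f = length (deduplicate ℤ._≟_ (map f (allFin n)))

Enumerates : ∀ {n} → ((Fin n → ℤ) → Set) → List (Fin n → ℤ) → Set
Enumerates P L =
    (∀ f → P f → ∃ λ g → g ∈ L × g ≗ f)
  × (∀ g → g ∈ L → P g)
  × AllPairs (λ g h → ¬ (g ≗ h)) L

-- average of rng over a list (the empty list never occurs in our use)
avgRng : ∀ {n} → List (Fin n → ℤ) → ℚ
avgRng [] = 0ℚ
avgRng {n} (f ∷ fs) = (+ sum (map rng (f ∷ fs))) / suc (length fs)

-- avg_P(G) = q : the set of maps satisfying P is finite, and its average range is q
AvgRangeIs : (G : RootedGraph) → ((Fin (size G) → ℤ) → Set) → ℚ → Set
AvgRangeIs G P q = Σ (List (Fin (size G) → ℤ)) λ L → Enumerates P L × avgRng L ≡ q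

_/pow_^_ : ℤ → (b : ℕ) → .{{NonZero b}} → ℕ → ℚ
_/pow_^_ a b e = _/_ a (b ℕ.^ e) {{m^n≢0 b e}}

-- A labelling of the star rooted at its centre is just the vector v of leaf values, each
-- leaf being free in {-1,0,1} (Lipschitz) or {-1,1} (strong).  Its range is
-- 1 + [1 occurs in v] + [-1 occurs in v].  Over an alphabet of k+1 letters, exactly
-- (k+1)^m - k^m of the (k+1)^m vectors contain a given letter, so the total range is
-- 3(k+1)^m - 2k^m and the average range is 3 - 2k^m/(k+1)^m; take k = 2 and k = 1.
module Submission where

open import Defs
open import Data.Nat using (ℕ; suc; _≤_; _^_; _∸_)
open import Data.Integer using (+_)
open import Data.Rational using (ℚ; _-_; _/_)
open import Data.Product using (_×_)

open import Data.Bool.Base using (true; false; if_then_else_)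
open import Data.Empty using (⊥-elim)
open import Data.Fin.Base using (Fin; zero; suc)
open import Data.Integer.Base as ℤ using (ℤ; -[1+_]; ∣_∣; 0ℤ; 1ℤ; -1ℤ)
import Data.Integer.Properties as ℤ
import Data.Integer.Tactic.RingSolver as ℤ-Solver
open import Data.List.Base as List
  using (List; []; _∷_; map; length; filter; deduplicate; cartesianProductWith)
open import Data.List.Properties using (map-++; map-∘; map-cong; map-cong-local; length-++; length-map; map-tabulate)
open import Data.List.Membership.Propositional using (_∈_)
open import Data.List.Membership.Propositional.Properties
  using (∈-map⁺; ∈-map⁻; ∈-cartesianProductWith⁺; ∈-cartesianProductWith⁻; ∈-filter⁺; ∈-filter⁻; ∈-deduplicate⁺; ∈-deduplicate⁻)
open import Data.List.Membership.Propositional.Properties.WithK using (unique∧set⇒bag)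
open import Data.List.Relation.Binary.BagAndSetEquality using (∼bag⇒↭)
open import Data.List.Relation.Binary.Permutation.Propositional.Properties using (↭-length)
open import Data.List.Relation.Unary.All as All using (All; []; _∷_)
open import Data.List.Relation.Unary.AllPairs as AllPairs using (AllPairs; []; _∷_)
import Data.List.Relation.Unary.AllPairs.Properties as AllPairsₚ
open import Data.List.Relation.Unary.Any using (here; there)
open import Data.List.Relation.Unary.Unique.Propositional using (Unique)
import Data.List.Relation.Unary.Unique.Propositional.Properties as Unique
open import Data.Nat.Base as ℕ using (zero; NonZero; _+_; _*_)
open import Data.Nat.ListAction using (sum)
open import Data.Nat.ListAction.Properties using (sum-++)
open import Data.Nat.Properties using (*-identityʳ; +-identityʳ; m^n≢0; ^-zeroˡ; +-assoc; +-cancelʳ-≡; *-distribʳ-+)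
open import Data.Nat.Tactic.RingSolver using (solve-∀)
open import Data.Product using (_,_; proj₂; ∃)
import Data.Rational.Base as ℚ
import Data.Rational.Properties as ℚ
import Data.Rational.Unnormalised.Base as ℚᵘ
import Data.Rational.Unnormalised.Properties as ℚᵘ
open import Data.Sum using (inj₁; inj₂)
open import Data.Vec.Base as Vec using (Vec; []; _∷_; lookup; toList)
open import Data.Vec.Properties using (∷-injective; lookup∘tabulate; tabulate-cong; tabulate∘lookup)
open import Data.Vec.Membership.Propositional.Properties using (∈-lookup; ∈-toList⁺)
open import Function.Base using (_∘_)
open import Function.Bundles using (_⇔_; mk⇔; Equivalence)
open import Function.Construct.Composition using (_⇔-∘_)
open import Function.Construct.Symmetry using (⇔-sym)
open import Relation.Binary.Definitions using (DecidableEquality)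
open import Relation.Binary.PropositionalEquality
  using (_≡_; _≢_; refl; sym; trans; cong; cong₂; subst; module ≡-Reasoning)
open import Relation.Nullary.Decidable using (does; dec-true; dec-false)
open import Relation.Nullary.Negation using (¬_)

sum-map-+ : ∀ {A : Set} (f g : A → ℕ) xs →
            sum (map (λ x → f x + g x) xs) ≡ sum (map f xs) + sum (map g xs)
sum-map-+ f g [] = refl
sum-map-+ f g (x ∷ xs) rewrite sum-map-+ f g xs = interchange (f x) (g x) _ _
  where
  interchange : ∀ a b c d → a + b + (c + d) ≡ a + c + (b + d)
  interchange = solve-∀

sum-map-const : ∀ {A : Set} n (xs : List A) → sum (map (λ _ → n) xs) ≡ length xs * n
sum-map-const n [] = refl
sum-map-const n (x ∷ xs) = cong (_+_ n) (sum-map-const n xs)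

sum-map-cartesianProductWith : ∀ {A B C : Set} (f : A → B → C) (g : C → ℕ) xs ys →
  sum (map g (cartesianProductWith f xs ys)) ≡ sum (map (λ x → sum (map (g ∘ f x) ys)) xs)
sum-map-cartesianProductWith f g [] ys = refl
sum-map-cartesianProductWith f g (x ∷ xs) ys = begin
  sum (map g (map (f x) ys List.++ cartesianProductWith f xs ys))
    ≡⟨ cong sum (map-++ g (map (f x) ys) _) ⟩
  sum (map g (map (f x) ys) List.++ map g (cartesianProductWith f xs ys))
    ≡⟨ sum-++ (map g (map (f x) ys)) _ ⟩
  sum (map g (map (f x) ys)) + sum (map g (cartesianProductWith f xs ys))
    ≡⟨ cong₂ _+_ (cong sum (sym (map-∘ ys))) (sum-map-cartesianProductWith f g xs ys) ⟩
  sum (map (g ∘ f x) ys) + sum (map (λ x → sum (map (g ∘ f x) ys)) xs)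
    ∎
  where open ≡-Reasoning

length-cartesianProductWith : ∀ {A B C : Set} (f : A → B → C) xs ys →
  length (cartesianProductWith f xs ys) ≡ length xs * length ys
length-cartesianProductWith f [] ys = refl
length-cartesianProductWith f (x ∷ xs) ys =
  trans (length-++ (map (f x) ys))
        (cong₂ _+_ (length-map (f x) ys) (length-cartesianProductWith f xs ys))

vectors : ∀ {A : Set} → List A → (m : ℕ) → List (Vec A m)
vectors cs zero    = [] ∷ []
vectors cs (suc m) = cartesianProductWith _∷_ cs (vectors cs m)

module _ {A : Set} {cs : List A} where

  length-vectors : ∀ m → length (vectors cs m) ≡ length cs ^ m
  length-vectors zero    = refl
  length-vectors (suc m) =
    trans (length-cartesianProductWith _∷_ cs (vectors cs m)) (cong (length cs *_) (length-vectors m))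

  ∈-vectors⁺ : ∀ {m} (v : Vec A m) → (∀ i → lookup v i ∈ cs) → v ∈ vectors cs m
  ∈-vectors⁺ []      _      = here refl
  ∈-vectors⁺ (c ∷ v) c∷v⊆cs = ∈-cartesianProductWith⁺ _∷_ (c∷v⊆cs zero) (∈-vectors⁺ v (c∷v⊆cs ∘ suc))

  ∈-vectors⁻ : ∀ m {v : Vec A m} {x} → v ∈ vectors cs m → x ∈ toList v → x ∈ cs
  ∈-vectors⁻ zero    (here refl) ()
  ∈-vectors⁻ (suc m) v∈ x∈ with ∈-cartesianProductWith⁻ _∷_ cs (vectors cs m) v∈
  ∈-vectors⁻ (suc m) v∈ (here refl) | c , w , c∈ , w∈ , refl = c∈
  ∈-vectors⁻ (suc m) v∈ (there x∈)  | c , w , c∈ , w∈ , refl = ∈-vectors⁻ m w∈ x∈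

  vectors-unique : Unique cs → ∀ m → Unique (vectors cs m)
  vectors-unique cs! zero    = [] ∷ []
  vectors-unique cs! (suc m) = Unique.cartesianProductWith⁺ _∷_ ∷-injective cs! (vectors-unique cs! m)

module Counting {A : Set} (_≟_ : DecidableEquality A) where

  open import Data.List.Membership.DecPropositional _≟_ using (_∈?_)
  open import Data.List.Relation.Unary.Unique.DecPropositional.Properties _≟_ using (deduplicate-!)

  𝟙[_∈_] : A → List A → ℕ
  𝟙[ x ∈ xs ] = if does (x ∈? xs) then 1 else 0

  length-filter-∈? : ∀ xs U → length (filter (_∈? xs) U) ≡ sum (map (λ u → 𝟙[ u ∈ xs ]) U)
  length-filter-∈? xs []      = refl
  length-filter-∈? xs (u ∷ U) with does (u ∈? xs)
  ... | true  = cong suc (length-filter-∈? xs U)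
  ... | false = length-filter-∈? xs U

  length-deduplicate : ∀ {U xs} → Unique U → (∀ {x} → x ∈ xs → x ∈ U) →
                       length (deduplicate _≟_ xs) ≡ sum (map (λ u → 𝟙[ u ∈ xs ]) U)
  length-deduplicate {U} {xs} U! xs⊆U =
    trans (↭-length (∼bag⇒↭ (unique∧set⇒bag (deduplicate-! xs) (Unique.filter⁺ (_∈? xs) {U} U!) (mk⇔ to from))))
          (length-filter-∈? xs U)
    where
    to : ∀ {x} → x ∈ deduplicate _≟_ xs → x ∈ filter (_∈? xs) U
    to x∈ = let x∈xs = ∈-deduplicate⁻ _≟_ xs x∈ in ∈-filter⁺ (_∈? xs) (xs⊆U x∈xs) x∈xs
    from : ∀ {x} → x ∈ filter (_∈? xs) U → x ∈ deduplicate _≟_ xs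
    from x∈ = ∈-deduplicate⁺ _≟_ (proj₂ (∈-filter⁻ (_∈? xs) {xs = U} x∈))

  sum-if-≟-avoiding : ∀ {c} a b {cs} → All (c ≢_) cs →
    sum (map (λ c′ → if does (c ≟ c′) then a else b) cs) ≡ length cs * b
  sum-if-≟-avoiding a b []                  = refl
  sum-if-≟-avoiding {c} a b {c′ ∷ _} (c≢c′ ∷ c∉) rewrite dec-false (c ≟ c′) c≢c′ =
    cong (_+_ b) (sum-if-≟-avoiding a b c∉)

  -- b is added on both sides to avoid the truncated subtraction length cs ∸ 1.
  sum-if-≟ : ∀ {c} a b {cs} → Unique cs → c ∈ cs →
    sum (map (λ c′ → if does (c ≟ c′) then a else b) cs) + b ≡ a + length cs * b
  sum-if-≟ {c} a b {c ∷ cs} (c∉ ∷ _) (here refl)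
    rewrite dec-true (c ≟ c) refl | sum-if-≟-avoiding a b c∉ = shuffle a b (length cs * b)
    where
    shuffle : ∀ a b n → a + n + b ≡ a + (b + n)
    shuffle = solve-∀
  sum-if-≟ {c} a b {c′ ∷ cs} (c′∉ ∷ cs!) (there c∈)
    rewrite dec-false (c ≟ c′) (All.lookup c′∉ c∈ ∘ sym) = begin
      b + Σ + b       ≡⟨ +-assoc b Σ b ⟩
      b + (Σ + b)     ≡⟨ cong (_+_ b) (sum-if-≟ a b cs! c∈) ⟩
      b + (a + n * b) ≡⟨ swap b a (n * b) ⟩
      a + (b + n * b) ∎
    where
    open ≡-Reasoning
    Σ = sum (map (λ c′ → if does (c ≟ c′) then a else b) cs)
    n = length cs
    swap : ∀ x y z → x + (y + z) ≡ y + (x + z)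
    swap = solve-∀

  #containing : A → List A → ℕ → ℕ
  #containing c cs m = sum (map (λ v → 𝟙[ c ∈ toList v ]) (vectors cs m))

  sum-𝟙-∈-∷ : ∀ c c′ {m} (V : List (Vec A m)) →
    sum (map (λ w → 𝟙[ c ∈ c′ ∷ toList w ]) V)
      ≡ (if does (c ≟ c′) then length V else sum (map (λ w → 𝟙[ c ∈ toList w ]) V))
  sum-𝟙-∈-∷ c c′ V with does (c ≟ c′)
  ... | true  = trans (sum-map-const 1 V) (*-identityʳ (length V))
  ... | false = refl

  #containing-suc : ∀ {c cs} → Unique cs → c ∈ cs → ∀ m →
    #containing c cs (suc m) + #containing c cs m ≡ length cs ^ m + length cs * #containing c cs m
  #containing-suc {c} {cs} cs! c∈ m = begin
    sum (map (λ v → 𝟙[ c ∈ toList v ]) (cartesianProductWith _∷_ cs V)) + N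
      ≡⟨ cong (_+ N) (sum-map-cartesianProductWith _∷_ (λ v → 𝟙[ c ∈ toList v ]) cs V) ⟩
    sum (map (λ c′ → sum (map (λ w → 𝟙[ c ∈ c′ ∷ toList w ]) V)) cs) + N
      ≡⟨ cong (λ s → sum s + N) (map-cong (λ c′ → sum-𝟙-∈-∷ c c′ V) cs) ⟩
    sum (map (λ c′ → if does (c ≟ c′) then length V else N) cs) + N
      ≡⟨ sum-if-≟ (length V) N cs! c∈ ⟩
    length V + length cs * N
      ≡⟨ cong (_+ length cs * N) (length-vectors m) ⟩
    length cs ^ m + length cs * N
      ∎
    where
    open ≡-Reasoning
    V = vectors cs m
    N = #containing c cs m

  #containing+^≡^ : ∀ {c cs k} → Unique cs → c ∈ cs → length cs ≡ suc k → ∀ m →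
    #containing c cs m + k ^ m ≡ suc k ^ m
  #containing+^≡^ cs! c∈ |cs| zero = refl
  #containing+^≡^ {c} {cs} {k} cs! c∈ |cs| (suc m) =
    +-cancelʳ-≡ N _ _ (begin
      N′ + k * k ^ m + N           ≡⟨ swap N′ (k * k ^ m) N ⟩
      N′ + N + k * k ^ m           ≡⟨ cong (_+ k * k ^ m) (#containing-suc cs! c∈ m) ⟩
      length cs ^ m + length cs * N + k * k ^ m
                                   ≡⟨ cong (λ K → K ^ m + K * N + k * k ^ m) |cs| ⟩
      suc k ^ m + suc k * N + k * k ^ m
                                   ≡⟨ cong (λ t → t + suc k * N + k * k ^ m) (sym ih) ⟩
      N + k ^ m + suc k * N + k * k ^ m
                                   ≡⟨ regroup N (k ^ m) k ⟩
      suc k * (N + k ^ m) + N      ≡⟨ cong (λ t → suc k * t + N) ih ⟩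
      suc k * suc k ^ m + N        ∎)
    where
    open ≡-Reasoning
    N  = #containing c cs m
    N′ = #containing c cs (suc m)
    ih = #containing+^≡^ cs! c∈ |cs| m
    swap : ∀ x y z → x + y + z ≡ x + z + y
    swap = solve-∀
    regroup : ∀ n t k → n + t + suc k * n + k * t ≡ suc k * (n + t) + n
    regroup = solve-∀

open Counting ℤ._≟_

labelling : ∀ {m} → Vec ℤ m → Fin (suc m) → ℤ
labelling v = lookup (0ℤ ∷ v)

starLabellings : List ℤ → (m : ℕ) → List (Fin (suc m) → ℤ)
starLabellings cs m = map labelling (vectors cs m)

StarLabelling : (ℤ → Set) → ∀ {m} → (Fin (suc m) → ℤ) → Set
StarLabelling Q f = f zero ≡ 0ℤ × (∀ i → Q (f (suc i)))

labelling-injective : ∀ {m} {u w : Vec ℤ m} → labelling u ≗ labelling w → u ≡ w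
labelling-injective {u = u} {w} u≗w =
  trans (sym (tabulate∘lookup u)) (trans (tabulate-cong (u≗w ∘ suc)) (tabulate∘lookup w))

starLabellings-enumerate : ∀ {cs} m → Unique cs → Enumerates (StarLabelling (_∈ cs)) (starLabellings cs m)
starLabellings-enumerate {cs} m cs! = complete , sound , distinct
  where
  complete : ∀ f → StarLabelling (_∈ cs) f → ∃ λ g → g ∈ starLabellings cs m × g ≗ f
  complete f (f0 , leaves) = labelling v , ∈-map⁺ labelling (∈-vectors⁺ v v⊆cs) , agrees
    where
    v = Vec.tabulate (f ∘ suc)
    v⊆cs : ∀ i → lookup v i ∈ cs
    v⊆cs i = subst (_∈ cs) (sym (lookup∘tabulate (f ∘ suc) i)) (leaves i)
    agrees : labelling v ≗ f
    agrees zero    = sym f0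
    agrees (suc i) = lookup∘tabulate (f ∘ suc) i
  sound : ∀ g → g ∈ starLabellings cs m → StarLabelling (_∈ cs) g
  sound g g∈ with ∈-map⁻ labelling g∈
  ... | v , v∈ , refl = refl , λ i → ∈-vectors⁻ m v∈ (∈-toList⁺ (∈-lookup i v))
  distinct : AllPairs (λ g h → ¬ (g ≗ h)) (starLabellings cs m)
  distinct = AllPairsₚ.map⁺ (AllPairs.map (λ u≢w → u≢w ∘ labelling-injective) (vectors-unique cs! m))

Enumerates-resp-⇔ : ∀ {n} {P Q : (Fin n → ℤ) → Set} {L} → (∀ f → P f ⇔ Q f) → Enumerates P L → Enumerates Q L
Enumerates-resp-⇔ P⇔Q (complete , sound , distinct) =
  (λ f → complete f ∘ Equivalence.from (P⇔Q f)) , (λ g → Equivalence.to (P⇔Q g) ∘ sound g) , distinct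

StarLabelling-cong : ∀ {Q Q′ : ℤ → Set} {m} {f : Fin (suc m) → ℤ} →
  (∀ x → Q x ⇔ Q′ x) → StarLabelling Q f ⇔ StarLabelling Q′ f
StarLabelling-cong Q⇔Q′ = mk⇔
  (λ (f0 , leaves) → f0 , λ i → Equivalence.to (Q⇔Q′ _) (leaves i))
  (λ (f0 , leaves) → f0 , λ i → Equivalence.from (Q⇔Q′ _) (leaves i))

star-edges⇔ : ∀ (R : ℕ → Set) {m} (f : Fin (suc m) → ℤ) →
  (f zero ≡ 0ℤ × (∀ u v → Adj (Star m) u v → R ∣ f u ℤ.- f v ∣)) ⇔ StarLabelling (R ∘ ∣_∣) f
star-edges⇔ R {m} f = mk⇔
  (λ (f0 , edge) → f0 , λ i → subst R (∣x-root∣ f0 (f (suc i))) (edge (suc i) zero (inj₂ (refl , λ ()))))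
  (λ (f0 , leaves) → f0 , edge f0 leaves)
  where
  ∣x-root∣ : f zero ≡ 0ℤ → ∀ x → ∣ x ℤ.- f zero ∣ ≡ ∣ x ∣
  ∣x-root∣ f0 x rewrite f0 = cong ∣_∣ (ℤ.+-identityʳ x)
  ∣root-x∣ : f zero ≡ 0ℤ → ∀ x → ∣ f zero ℤ.- x ∣ ≡ ∣ x ∣
  ∣root-x∣ f0 x = trans (ℤ.∣i-j∣≡∣j-i∣ (f zero) x) (∣x-root∣ f0 x)
  edge : f zero ≡ 0ℤ → (∀ i → R ∣ f (suc i) ∣) → ∀ u v → Adj (Star m) u v → R ∣ f u ℤ.- f v ∣
  edge f0 leaves .zero zero    (inj₁ (refl , v≢0)) = ⊥-elim (v≢0 refl)
  edge f0 leaves .zero (suc i) (inj₁ (refl , _))   = subst R (sym (∣root-x∣ f0 (f (suc i)))) (leaves i)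
  edge f0 leaves zero    .zero (inj₂ (refl , u≢0)) = ⊥-elim (u≢0 refl)
  edge f0 leaves (suc i) .zero (inj₂ (refl , _))   = subst R (sym (∣x-root∣ f0 (f (suc i)))) (leaves i)

unitBall unitSphere : List ℤ
unitBall   = 0ℤ ∷ 1ℤ ∷ -1ℤ ∷ []
unitSphere = 1ℤ ∷ -1ℤ ∷ []

unitBall-unique : Unique unitBall
unitBall-unique = ((λ ()) ∷ (λ ()) ∷ []) ∷ ((λ ()) ∷ []) ∷ [] ∷ []

unitSphere-unique : Unique unitSphere
unitSphere-unique = ((λ ()) ∷ []) ∷ [] ∷ []

∣x∣≤1⇔x∈unitBall : ∀ x → (∣ x ∣ ≤ 1) ⇔ (x ∈ unitBall)
∣x∣≤1⇔x∈unitBall x = mk⇔ (to x) from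
  where
  to : ∀ x → ∣ x ∣ ≤ 1 → x ∈ unitBall
  to (+ 0)          _           = here refl
  to (+ 1)          _           = there (here refl)
  to (+ suc (suc n)) (ℕ.s≤s ())
  to -[1+ 0 ]       _           = there (there (here refl))
  to -[1+ suc n ]   (ℕ.s≤s ())
  from : ∀ {x} → x ∈ unitBall → ∣ x ∣ ≤ 1
  from (here refl)                 = ℕ.z≤n
  from (there (here refl))         = ℕ.s≤s ℕ.z≤n
  from (there (there (here refl))) = ℕ.s≤s ℕ.z≤n

∣x∣≡1⇔x∈unitSphere : ∀ x → (∣ x ∣ ≡ 1) ⇔ (x ∈ unitSphere)
∣x∣≡1⇔x∈unitSphere x = mk⇔ (to x) from
  where
  to : ∀ x → ∣ x ∣ ≡ 1 → x ∈ unitSphere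
  to (+ 1)    _ = here refl
  to -[1+ 0 ] _ = there (here refl)
  from : ∀ {x} → x ∈ unitSphere → ∣ x ∣ ≡ 1
  from (here refl)         = refl
  from (there (here refl)) = refl

lipschitz⇔unitBall : ∀ {m} (f : Fin (suc m) → ℤ) → IsLipschitz (Star m) 1 f ⇔ StarLabelling (_∈ unitBall) f
lipschitz⇔unitBall f = StarLabelling-cong {f = f} ∣x∣≤1⇔x∈unitBall ⇔-∘ star-edges⇔ (_≤ 1) f

strongLipschitz⇔unitSphere : ∀ {m} (f : Fin (suc m) → ℤ) →
  IsStrongLipschitz (Star m) 1 f ⇔ StarLabelling (_∈ unitSphere) f
strongLipschitz⇔unitSphere f = StarLabelling-cong {f = f} ∣x∣≡1⇔x∈unitSphere ⇔-∘ star-edges⇔ (_≡ 1) f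

lipschitz-enumerate : ∀ m → Enumerates (IsLipschitz (Star m) 1) (starLabellings unitBall m)
lipschitz-enumerate m =
  Enumerates-resp-⇔ (λ f → ⇔-sym (lipschitz⇔unitBall f)) (starLabellings-enumerate m unitBall-unique)

strongLipschitz-enumerate : ∀ m → Enumerates (IsStrongLipschitz (Star m) 1) (starLabellings unitSphere m)
strongLipschitz-enumerate m =
  Enumerates-resp-⇔ (λ f → ⇔-sym (strongLipschitz⇔unitSphere f)) (starLabellings-enumerate m unitSphere-unique)

tabulate-lookup : ∀ {A : Set} {m} (v : Vec A m) → List.tabulate (lookup v) ≡ toList v
tabulate-lookup []      = refl
tabulate-lookup (x ∷ v) = cong (x ∷_) (tabulate-lookup v)

rng-labelling : ∀ {m} (v : Vec ℤ m) → rng (labelling v) ≡ length (deduplicate ℤ._≟_ (0ℤ ∷ toList v))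
rng-labelling v =
  cong (length ∘ deduplicate ℤ._≟_) (trans (map-tabulate (λ i → i) (labelling v)) (tabulate-lookup (0ℤ ∷ v)))

rng-labelling-unitBall : ∀ {m} (v : Vec ℤ m) → (∀ {x} → x ∈ toList v → x ∈ unitBall) →
  rng (labelling v) ≡ 1 + (𝟙[ 1ℤ ∈ toList v ] + 𝟙[ -1ℤ ∈ toList v ])
rng-labelling-unitBall v v⊆ = begin
  rng (labelling v)                                       ≡⟨ rng-labelling v ⟩
  length (deduplicate ℤ._≟_ (0ℤ ∷ toList v))              ≡⟨ length-deduplicate unitBall-unique 0∷v⊆ ⟩
  1 + (𝟙[ 1ℤ ∈ toList v ] + (𝟙[ -1ℤ ∈ toList v ] + 0)) ≡⟨ cong (λ n → 1 + (𝟙[ 1ℤ ∈ toList v ] + n)) (+-identityʳ _) ⟩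
  1 + (𝟙[ 1ℤ ∈ toList v ] + 𝟙[ -1ℤ ∈ toList v ])        ∎
  where
  open ≡-Reasoning
  0∷v⊆ : ∀ {x} → x ∈ 0ℤ ∷ toList v → x ∈ unitBall
  0∷v⊆ (here refl) = here refl
  0∷v⊆ (there x∈)  = v⊆ x∈

sum-rng-starLabellings : ∀ {cs} m → (∀ {x} → x ∈ cs → x ∈ unitBall) →
  sum (map rng (starLabellings cs m)) ≡ length cs ^ m + (#containing 1ℤ cs m + #containing -1ℤ cs m)
sum-rng-starLabellings {cs} m cs⊆ = begin
  sum (map rng (map labelling V))
    ≡⟨ cong sum (sym (map-∘ V)) ⟩
  sum (map (rng ∘ labelling) V)
    ≡⟨ cong sum (map-cong-local (All.tabulate λ v∈ → rng-labelling-unitBall _ (cs⊆ ∘ ∈-vectors⁻ m v∈))) ⟩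
  sum (map (λ v → 1 + (𝟙[ 1ℤ ∈ toList v ] + 𝟙[ -1ℤ ∈ toList v ])) V)
    ≡⟨ sum-map-+ (λ _ → 1) _ V ⟩
  sum (map (λ _ → 1) V) + sum (map (λ v → 𝟙[ 1ℤ ∈ toList v ] + 𝟙[ -1ℤ ∈ toList v ]) V)
    ≡⟨ cong₂ _+_ (trans (sum-map-const 1 V) (trans (*-identityʳ _) (length-vectors m))) (sum-map-+ _ _ V) ⟩
  length cs ^ m + (#containing 1ℤ cs m + #containing -1ℤ cs m)
    ∎
  where
  open ≡-Reasoning
  V = vectors cs m

sum-rng-starLabellings+2k^m : ∀ {cs k} m → Unique cs → (∀ {x} → x ∈ cs → x ∈ unitBall) →
  1ℤ ∈ cs → -1ℤ ∈ cs → length cs ≡ suc k →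
  sum (map rng (starLabellings cs m)) + 2 * k ^ m ≡ 3 * suc k ^ m
sum-rng-starLabellings+2k^m {cs} {k} m cs! cs⊆ 1∈ -1∈ |cs| = begin
  sum (map rng (starLabellings cs m)) + 2 * k ^ m
    ≡⟨ cong (_+ 2 * k ^ m) (sum-rng-starLabellings m cs⊆) ⟩
  length cs ^ m + (N₁ + N₋₁) + 2 * k ^ m
    ≡⟨ regroup (length cs ^ m) N₁ N₋₁ (k ^ m) ⟩
  length cs ^ m + (N₁ + k ^ m) + (N₋₁ + k ^ m)
    ≡⟨ cong₂ _+_ (cong₂ _+_ (cong (_^ m) |cs|) (#containing+^≡^ cs! 1∈ |cs| m))
                             (#containing+^≡^ cs! -1∈ |cs| m) ⟩
  suc k ^ m + suc k ^ m + suc k ^ m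
    ≡⟨ triple (suc k ^ m) ⟩
  3 * suc k ^ m
    ∎
  where
  open ≡-Reasoning
  N₁  = #containing 1ℤ cs m
  N₋₁ = #containing -1ℤ cs m
  regroup : ∀ n a b t → n + (a + b) + 2 * t ≡ n + (a + t) + (b + t)
  regroup = solve-∀
  triple : ∀ n → n + n + n ≡ 3 * n
  triple = solve-∀

avgRng-≡ : ∀ {n} (L : List (Fin n → ℤ)) {d S} .{{_ : NonZero d}} →
           length L ≡ d → sum (map rng L) ≡ S → avgRng L ≡ (+ S) / d
avgRng-≡ (f ∷ fs) refl refl = refl  -- L = [] would force the instance NonZero 0

mkℚᵘ≃3-mkℚᵘ : ∀ S B d-1 e-1 → let d = suc d-1; e = suc e-1 in S * e + B * d ≡ 3 * d * e →
  ℚᵘ.mkℚᵘ (+ S) d-1 ℚᵘ.≃ ℚᵘ.mkℚᵘ (+ 3) 0 ℚᵘ.- ℚᵘ.mkℚᵘ (+ B) e-1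
mkℚᵘ≃3-mkℚᵘ S B d-1 e-1 eq = ℚᵘ.*≡* (begin
  + S ℤ.* (+ 1 ℤ.* + e)                          ≡⟨ add-sub (+ S) (+ B) (+ d) (+ e) ⟩
  + S ℤ.* + e ℤ.+ + B ℤ.* + d ℤ.- + B ℤ.* + d   ≡⟨ cong (ℤ._- + B ℤ.* + d) eqℤ ⟩
  + 3 ℤ.* + d ℤ.* + e ℤ.- + B ℤ.* + d           ≡⟨ factor (+ B) (+ d) (+ e) ⟩
  (+ 3 ℤ.* + e ℤ.+ ℤ.- + B ℤ.* + 1) ℤ.* + d      ∎)
  where
  open ≡-Reasoning
  d = suc d-1
  e = suc e-1
  eqℤ : + S ℤ.* + e ℤ.+ + B ℤ.* + d ≡ + 3 ℤ.* + d ℤ.* + e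
  eqℤ = begin
    + S ℤ.* + e ℤ.+ + B ℤ.* + d   ≡⟨ sym (cong₂ ℤ._+_ (ℤ.pos-* S e) (ℤ.pos-* B d)) ⟩
    + (S * e) ℤ.+ + (B * d)       ≡⟨ sym (ℤ.pos-+ (S * e) (B * d)) ⟩
    + (S * e + B * d)             ≡⟨ cong +_ eq ⟩
    + (3 * d * e)                 ≡⟨ trans (ℤ.pos-* (3 * d) e) (cong (ℤ._* + e) (ℤ.pos-* 3 d)) ⟩
    + 3 ℤ.* + d ℤ.* + e           ∎
  add-sub : ∀ s b x y → s ℤ.* (+ 1 ℤ.* y) ≡ s ℤ.* y ℤ.+ b ℤ.* x ℤ.- b ℤ.* x
  add-sub = ℤ-Solver.solve-∀
  factor : ∀ b x y → + 3 ℤ.* x ℤ.* y ℤ.- b ℤ.* x ≡ (+ 3 ℤ.* y ℤ.+ ℤ.- b ℤ.* + 1) ℤ.* x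
  factor = ℤ-Solver.solve-∀

-- ℚ's _/_ normalises, so the identity is checked in ℚᵘ, where toℚᵘ (i / suc n) ≃ mkℚᵘ i n.
/≡3-/ : ∀ S B d e .{{_ : NonZero d}} .{{_ : NonZero e}} →
        S * e + B * d ≡ 3 * d * e → (+ S) / d ≡ (+ 3) / 1 - (+ B) / e
/≡3-/ S B d@(suc d-1) e@(suc e-1) eq = ℚ.toℚᵘ-injective (begin
  ℚ.toℚᵘ ((+ S) / d)                               ≈⟨ ℚ.toℚᵘ-fromℚᵘ (ℚᵘ.mkℚᵘ (+ S) d-1) ⟩
  ℚᵘ.mkℚᵘ (+ S) d-1                                ≈⟨ mkℚᵘ≃3-mkℚᵘ S B d-1 e-1 eq ⟩
  ℚᵘ.mkℚᵘ (+ 3) 0 ℚᵘ.- ℚᵘ.mkℚᵘ (+ B) e-1           ≈⟨ ℚᵘ.+-congʳ (ℚᵘ.mkℚᵘ (+ 3) 0) (ℚᵘ.-‿cong (ℚ.toℚᵘ-fromℚᵘ (ℚᵘ.mkℚᵘ (+ B) e-1))) ⟨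
  ℚ.toℚᵘ ((+ 3) / 1) ℚᵘ.- ℚ.toℚᵘ ((+ B) / e)      ≈⟨ ℚᵘ.+-congʳ (ℚᵘ.mkℚᵘ (+ 3) 0) (ℚ.toℚᵘ-homo‿- ((+ B) / e)) ⟨
  ℚ.toℚᵘ ((+ 3) / 1) ℚᵘ.+ ℚ.toℚᵘ (ℚ.- ((+ B) / e)) ≈⟨ ℚ.toℚᵘ-homo-+ ((+ 3) / 1) (ℚ.- ((+ B) / e)) ⟨
  ℚ.toℚᵘ ((+ 3) / 1 - (+ B) / e)                   ∎)
  where open ℚᵘ.≃-Reasoning

starLabellings-avgRng : ∀ {cs k} m → Unique cs → (∀ {x} → x ∈ cs → x ∈ unitBall) →
  1ℤ ∈ cs → -1ℤ ∈ cs → length cs ≡ suc k →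
  ∀ B e .{{_ : NonZero e}} → B * suc k ^ m ≡ 2 * k ^ m * e →
  avgRng (starLabellings cs m) ≡ (+ 3) / 1 - (+ B) / e
starLabellings-avgRng {cs} {k} m cs! cs⊆ 1∈ -1∈ |cs| B e B*d≡2k^m*e =
  trans (avgRng-≡ (starLabellings cs m) {{m^n≢0 (suc k) m}} length≡d refl)
        (/≡3-/ S B d e {{m^n≢0 (suc k) m}} cross)
  where
  open ≡-Reasoning
  d = suc k ^ m
  S = sum (map rng (starLabellings cs m))
  length≡d : length (starLabellings cs m) ≡ d
  length≡d = trans (length-map labelling (vectors cs m)) (trans (length-vectors m) (cong (_^ m) |cs|))
  cross : S * e + B * d ≡ 3 * d * e
  cross = begin
    S * e + B * d          ≡⟨ cong (_+_ (S * e)) B*d≡2k^m*e ⟩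
    S * e + 2 * k ^ m * e  ≡⟨ sym (*-distribʳ-+ e S (2 * k ^ m)) ⟩
    (S + 2 * k ^ m) * e    ≡⟨ cong (_* e) (sum-rng-starLabellings+2k^m m cs! cs⊆ 1∈ -1∈ |cs|) ⟩
    3 * d * e              ∎

theorem3 : (m : ℕ) → 1 ≤ m →
    AvgRangeIs (Star m) (IsLipschitz (Star m) 1)
      (((+ 3) / 1) - ((+ (2 ^ suc m)) /pow 3 ^ (suc m ∸ 1)))
    × AvgRangeIs (Star m) (IsStrongLipschitz (Star m) 1)
      (((+ 3) / 1) - ((+ 4) /pow 2 ^ suc m))
theorem3 m _ =
    ( starLabellings unitBall m , lipschitz-enumerate m
    , starLabellings-avgRng m unitBall-unique (λ x∈ → x∈) (there (here refl)) (there (there (here refl))) refl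
        (2 ^ suc m) (3 ^ m) {{m^n≢0 3 m}} refl )
  , ( starLabellings unitSphere m , strongLipschitz-enumerate m
    , starLabellings-avgRng m unitSphere-unique there (here refl) (there (here refl)) refl
        4 (2 ^ suc m) {{m^n≢0 2 (suc m)}} 4*2^m≡2*1^m*2^[1+m] )
  where
  4*2^m≡2*1^m*2^[1+m] : 4 * 2 ^ m ≡ 2 * 1 ^ m * 2 ^ suc m
  4*2^m≡2*1^m*2^[1+m] rewrite ^-zeroˡ m = double (2 ^ m)
    where
    double : ∀ t → 4 * t ≡ 2 * 1 * (2 * t)
    double = solve-∀
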